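{- There exists a locally finite infinite tree that does not satisfy the neighbour sum property.
   Context: A tree is locally finite if every vertex has finite degree. A locally finite graph $\mathcal G=(\mathcal V,\mathcal E)$ satisfies the neighbour sum property if there exists $f:\mathcal V\to\mathbb R$ with $f\not\equiv 0$ such that $f(x)=\sum_{y:\{x,y\}\in\mathcal E} f(y)$ for every $x\in\mathcal V$. -}

module Defs where

open import Level using (0ℓ) renaming (suc to lsuc)
open import Data.Nat using (ℕ; zero; suc; _≤_)
open import Data.List using (List; []; _∷_; length)
open import Data.List.Membership.Propositional using (_∈_)
open import Data.List.Relation.Unary.Unique.Propositional using (Unique)
open import Data.Product using (Σ; ∃; _×_; _,_)
open import Data.Sum using (_⊎_)
open import Data.Empty using (⊥)
open import Relation.Nullary using (¬_)
open import Relation.Binary.PropositionalEquality using (_≡_)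
open import Algebra.Bundles using (CommutativeRing)

-- The real numbers, axiomatised as a (Dedekind-)complete ordered field.
-- Such a field is unique up to isomorphism, so quantifying over all of
-- them is the same as speaking about ℝ.

record RealField : Set₁ where
  field
    cring : CommutativeRing 0ℓ 0ℓ
  open CommutativeRing cring public
  field
    _≤ᴿ_        : Carrier → Carrier → Set
    0≉1        : ¬ (0# ≈ 1#)
    inverse    : ∀ x → ¬ (x ≈ 0#) → Σ Carrier λ y → (x * y) ≈ 1#
    ≤-resp-≈   : ∀ {x x′ y y′} → x ≈ x′ → y ≈ y′ → x ≤ᴿ y → x′ ≤ᴿ y′
    ≤-refl     : ∀ {x} → x ≤ᴿ x
    ≤-trans    : ∀ {x y z} → x ≤ᴿ y → y ≤ᴿ z → x ≤ᴿ z
    ≤-antisym  : ∀ {x y} → x ≤ᴿ y → y ≤ᴿ x → x ≈ y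
    ≤-total    : ∀ x y → (x ≤ᴿ y) ⊎ (y ≤ᴿ x)
    +-mono-≤   : ∀ {x y} z → x ≤ᴿ y → (x + z) ≤ᴿ (y + z)
    *-nonneg   : ∀ {x y} → 0# ≤ᴿ x → 0# ≤ᴿ y → 0# ≤ᴿ (x * y)
    sup        : (P : Carrier → Set) → (Σ Carrier P) →
                 (Σ Carrier λ b → ∀ x → P x → x ≤ᴿ b) →
                 Σ Carrier λ s → (∀ x → P x → x ≤ᴿ s) ×
                                 (∀ b → (∀ x → P x → x ≤ᴿ b) → s ≤ᴿ b)

-- Locally finite simple graphs, given by finite neighbour lists.

record LFGraph : Set₁ where
  field
    V     : Set
    nbrs  : V → List V
    nbrs-unique : ∀ x → Unique (nbrs x)
    irrefl : ∀ x → ¬ (x ∈ nbrs x)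
    sym    : ∀ {x y} → y ∈ nbrs x → x ∈ nbrs y

  Adj : V → V → Set
  Adj x y = y ∈ nbrs x

  data IsWalk : List V → Set where
    single : ∀ x → IsWalk (x ∷ [])
    step   : ∀ {x y ws} → Adj x y → IsWalk (y ∷ ws) → IsWalk (x ∷ y ∷ ws)

  data WalkFromTo : V → V → Set where
    here  : ∀ x → WalkFromTo x x
    there : ∀ {x y z} → Adj x y → WalkFromTo y z → WalkFromTo x z

  Connected : Set
  Connected = ∀ x y → WalkFromTo x y

  last : V → List V → V
  last x []       = x
  last x (y ∷ ys) = last y ys

  IsCycle : List V → Set
  IsCycle []       = ⊥
  IsCycle (x ∷ xs) = IsWalk (x ∷ xs) × Unique (x ∷ xs) × (3 ≤ length (x ∷ xs))
                     × Adj (last x xs) x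

  Acyclic : Set
  Acyclic = ∀ cs → ¬ IsCycle cs

  IsTree : Set
  IsTree = Connected × Acyclic

  Infinite : Set
  Infinite = ¬ (Σ (List V) λ xs → ∀ x → x ∈ xs)

  module _ (ℝ : RealField) where
    open RealField ℝ

    sumOver : (V → Carrier) → List V → Carrier
    sumOver f []       = 0#
    sumOver f (y ∷ ys) = f y + sumOver f ys

    NeighbourSumProperty : Set
    NeighbourSumProperty =
      Σ (V → Carrier) λ f → (¬ (∀ x → f x ≈ 0#)) × (∀ x → f x ≈ sumOver f (nbrs x))

-- The comb whose teeth are paths of length two: a spine 0, 1, 2, … and, at
-- every spine vertex s, a path s — m — t. A tooth forces f t = f m and
-- f m = f s + f t, so f vanishes on the spine; the neighbour sum at a spine
-- vertex then forces f m = 0, and hence f t = 0. It is a tree because every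
-- edge joins a vertex to its parent, one level closer to the root.
module Submission where

open import Defs
open import Data.Nat using (ℕ; zero; suc; _<_; s≤s)
open import Data.Nat.Properties using (≤-refl; n<1+n; <-trans; <-asym; <⇒≱)
open import Data.List using (List; []; _∷_; map)
open import Data.List.Extrema.Nat using (max; v≤max⁺)
open import Data.List.Membership.Propositional using (_∈_; _∉_; lose)
open import Data.List.Membership.Propositional.Properties using (∈-map⁺)
open import Data.List.Relation.Unary.Any using (here; there)
open import Data.List.Relation.Unary.All using (All; []; _∷_)
open import Data.List.Relation.Unary.All.Properties using (All¬⇒¬Any)
open import Data.List.Relation.Unary.AllPairs using ([]; _∷_)
open import Data.List.Relation.Unary.Unique.Propositional using (Unique)
open import Data.Product using (Σ; _×_; _,_; proj₁; proj₂)
open import Data.Sum using (_⊎_; inj₁; inj₂)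
open import Function using (_∘_)
open import Relation.Nullary using (¬_; contradiction)
open import Relation.Binary.PropositionalEquality using (_≡_; refl)
import Relation.Binary.PropositionalEquality as ≡
import Relation.Binary.Reasoning.Setoid as SetoidReasoning
import Algebra.Properties.Ring as RingProperties

module _ (G : LFGraph) where
  open LFGraph G renaming (sym to Adj-sym)

  _++ʷ_ : ∀ {x y z} → WalkFromTo x y → WalkFromTo y z → WalkFromTo x z
  here _    ++ʷ w′ = w′
  there a w ++ʷ w′ = there a (w ++ʷ w′)

  reverseʷ : ∀ {x y} → WalkFromTo x y → WalkFromTo y x
  reverseʷ (here x)    = here x
  reverseʷ (there a w) = reverseʷ w ++ʷ there (Adj-sym a) (here _)

  reachable⇒connected : (r : V) → (∀ x → WalkFromTo x r) → Connected
  reachable⇒connected r to-r x y = to-r x ++ʷ reverseʷ (to-r y)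

  unbounded⇒infinite : (rank : V → ℕ) → (∀ n → Σ V λ x → n < rank x) → Infinite
  unbounded⇒infinite rank unbounded (xs , complete) with unbounded (max 0 (map rank xs))
  ... | x , bound<rank =
    <⇒≱ bound<rank (v≤max⁺ 0 (map rank xs) (inj₂ (lose (∈-map⁺ rank (complete x)) ≤-refl)))

  last∈ : ∀ x xs → last x xs ∈ x ∷ xs
  last∈ x []       = here refl
  last∈ x (y ∷ ys) = there (last∈ y ys)

  module ParentEdges
    (parent : V → V) (depth : V → ℕ)
    (parent-edge : ∀ {x y} → Adj x y → y ≡ parent x ⊎ x ≡ parent y)
    (depth-parent : ∀ {x} → Adj x (parent x) → depth (parent x) < depth x)
    where

    depth-up : ∀ {x y} → Adj x y → y ≡ parent x → depth y < depth x
    depth-up a refl = depth-parent a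

    -- Once a path without repeated vertices steps down to a child, it can
    -- only keep stepping down: stepping back up would return to the parent.
    descent : ∀ {x y ws} → IsWalk (x ∷ y ∷ ws) → Unique (x ∷ y ∷ ws) →
              x ≡ parent y → depth x < depth (last y ws)
    descent {ws = []}    (step xy _) _ x≡py = depth-up (Adj-sym xy) x≡py
    descent {ws = z ∷ _} (step xy yw@(step yz _)) ((_ ∷ x≢z ∷ _) ∷ u) x≡py
      with parent-edge yz
    ... | inj₁ z≡py = contradiction (≡.trans x≡py (≡.sym z≡py)) x≢z
    ... | inj₂ y≡pz = <-trans (depth-up (Adj-sym xy) x≡py) (descent yw u y≡pz)

    ascent : ∀ {x y ws z} → IsWalk (x ∷ y ∷ ws) → Unique (x ∷ y ∷ ws) →
             Adj (last y ws) z → z ≡ parent (last y ws) → z ∉ x ∷ y ∷ ws →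
             depth z < depth x × y ≡ parent x
    ascent {ws = []} (step xy _) _ yz z≡py z∉ with parent-edge xy
    ... | inj₁ y≡px = <-trans (depth-up yz z≡py) (depth-up xy y≡px) , y≡px
    ... | inj₂ x≡py = contradiction (here (≡.trans z≡py (≡.sym x≡py))) z∉
    ascent {ws = w ∷ _} (step xy yw) ((_ ∷ x≢w ∷ _) ∷ u) lz z≡pl z∉
      with ascent yw u lz z≡pl (z∉ ∘ there) | parent-edge xy
    ... | z<y , _  | inj₁ y≡px = <-trans z<y (depth-up xy y≡px) , y≡px
    ... | _ , w≡py | inj₂ x≡py = contradiction (≡.trans x≡py (≡.sym w≡py)) x≢w

    -- Of the two cycle neighbours y and l of x at most one is the parent of x;
    -- by descent and ascent, the cycle cannot continue from the other one.
    acyclic : Acyclic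
    acyclic []               ()
    acyclic (_ ∷ [])         (_ , _ , s≤s () , _)
    acyclic (_ ∷ _ ∷ [])     (_ , _ , s≤s (s≤s ()) , _)
    acyclic (x ∷ y ∷ z ∷ ws) (step xy w , u@(x≢ ∷ y≢ ∷ u′) , _ , lx)
      with parent-edge lx | parent-edge xy
    ... | inj₂ l≡px | inj₁ y≡px =
      All¬⇒¬Any y≢ (≡.subst (_∈ z ∷ ws) (≡.trans l≡px (≡.sym y≡px)) (last∈ z ws))
    ... | inj₂ l≡px | inj₂ x≡py =
      <-asym (descent (step xy w) u x≡py) (depth-up (Adj-sym lx) l≡px)
    ... | inj₁ x≡pl | y-edge with ascent w (y≢ ∷ u′) lx x≡pl (All¬⇒¬Any x≢) | y-edge
    ...   | x<y , _  | inj₁ y≡px = <-asym x<y (depth-up xy y≡px)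
    ...   | _ , z≡py | inj₂ x≡py = All¬⇒¬Any x≢ (there (here (≡.trans x≡py (≡.sym z≡py))))

  module _ (ℝ : RealField) {f : V → RealField.Carrier ℝ}
           (f-sum : ∀ x → RealField._≈_ ℝ (f x) (sumOver ℝ f (nbrs x))) where
    open RealField ℝ renaming (refl to ≈-refl; trans to ≈-trans)
    open SetoidReasoning setoid
    open RingProperties ring using (+-identityˡ-unique)

    sum-at : ∀ {x ys} → nbrs x ≡ ys → f x ≈ sumOver ℝ f ys
    sum-at {x} refl = f-sum x

    sumOver-≈0 : ∀ {ys} → All (λ y → f y ≈ 0#) ys → sumOver ℝ f ys ≈ 0#
    sumOver-≈0 []          = ≈-refl
    sumOver-≈0 (fy≈0 ∷ ps) = ≈-trans (+-cong fy≈0 (sumOver-≈0 ps)) (+-identityʳ 0#)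

    neighbours≈0⇒≈0 : ∀ {x} → All (λ y → f y ≈ 0#) (nbrs x) → f x ≈ 0#
    neighbours≈0⇒≈0 {x} ps = ≈-trans (f-sum x) (sumOver-≈0 ps)

    remaining-neighbour≈0 : ∀ {x y ys} → nbrs x ≡ y ∷ ys → f x ≈ 0# →
                            All (λ z → f z ≈ 0#) ys → f y ≈ 0#
    remaining-neighbour≈0 {x} {y} {ys} nbrs-x fx≈0 ps = begin
      f y                    ≈⟨ +-identityʳ (f y) ⟨
      f y + 0#               ≈⟨ +-congˡ (sumOver-≈0 ps) ⟨
      f y + sumOver ℝ f ys   ≈⟨ sum-at nbrs-x ⟨
      f x                    ≈⟨ fx≈0 ⟩
      0#                     ∎

    pendant-path≈0 : ∀ {s m t} → nbrs m ≡ s ∷ t ∷ [] → nbrs t ≡ m ∷ [] → f s ≈ 0#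
    pendant-path≈0 {s} {m} {t} nbrs-m nbrs-t = +-identityˡ-unique (f s) (f m) (begin
      f s + f m              ≈⟨ +-congˡ ft≈fm ⟨
      f s + f t              ≈⟨ +-congˡ (+-identityʳ (f t)) ⟨
      f s + (f t + 0#)       ≈⟨ sum-at nbrs-m ⟨
      f m                    ∎)
      where
      ft≈fm : f t ≈ f m
      ft≈fm = ≈-trans (sum-at nbrs-t) (+-identityʳ (f m))

data Comb : Set where
  spine mid tip : ℕ → Comb

comb-nbrs : Comb → List Comb
comb-nbrs (spine zero)    = mid zero ∷ spine 1 ∷ []
comb-nbrs (spine (suc n)) = mid (suc n) ∷ spine (suc (suc n)) ∷ spine n ∷ []
comb-nbrs (mid n)         = spine n ∷ tip n ∷ []
comb-nbrs (tip n)         = mid n ∷ []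

comb-unique : ∀ x → Unique (comb-nbrs x)
comb-unique (spine zero)    = ((λ ()) ∷ []) ∷ [] ∷ []
comb-unique (spine (suc n)) = ((λ ()) ∷ (λ ()) ∷ []) ∷ ((λ ()) ∷ []) ∷ [] ∷ []
comb-unique (mid n)         = ((λ ()) ∷ []) ∷ [] ∷ []
comb-unique (tip n)         = [] ∷ []

comb-irrefl : ∀ x → x ∉ comb-nbrs x
comb-irrefl (spine zero)    (here ())
comb-irrefl (spine zero)    (there (here ()))
comb-irrefl (spine (suc n)) (here ())
comb-irrefl (spine (suc n)) (there (here ()))
comb-irrefl (spine (suc n)) (there (there (here ())))
comb-irrefl (mid n)         (here ())
comb-irrefl (mid n)         (there (here ()))
comb-irrefl (tip n)         (here ())

comb-sym : ∀ {x y} → y ∈ comb-nbrs x → x ∈ comb-nbrs y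
comb-sym {spine zero}          (here refl)                 = here refl
comb-sym {spine zero}          (there (here refl))         = there (there (here refl))
comb-sym {spine (suc n)}       (here refl)                 = here refl
comb-sym {spine (suc n)}       (there (here refl))         = there (there (here refl))
comb-sym {spine 1}             (there (there (here refl))) = there (here refl)
comb-sym {spine (suc (suc n))} (there (there (here refl))) = there (here refl)
comb-sym {mid zero}            (here refl)                 = here refl
comb-sym {mid (suc n)}         (here refl)                 = here refl
comb-sym {mid n}               (there (here refl))         = here refl
comb-sym {tip n}               (here refl)                 = there (here refl)

comb : LFGraph
comb = record
  { V           = Comb
  ; nbrs        = comb-nbrs
  ; nbrs-unique = comb-unique
  ; irrefl      = comb-irrefl
  ; sym         = comb-sym
  }

open LFGraph comb using (Adj; WalkFromTo; here; there)

-- spine 0 is the root; its parent is a junk value that is never adjacent to it.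
parent : Comb → Comb
parent (spine zero)    = spine zero
parent (spine (suc n)) = spine n
parent (mid n)         = spine n
parent (tip n)         = mid n

depth : Comb → ℕ
depth (spine n) = n
depth (mid n)   = suc n
depth (tip n)   = suc (suc n)

comb-parent-edge : ∀ {x y} → Adj x y → y ≡ parent x ⊎ x ≡ parent y
comb-parent-edge {spine zero}    (here refl)                 = inj₂ refl
comb-parent-edge {spine zero}    (there (here refl))         = inj₂ refl
comb-parent-edge {spine (suc n)} (here refl)                 = inj₂ refl
comb-parent-edge {spine (suc n)} (there (here refl))         = inj₂ refl
comb-parent-edge {spine (suc n)} (there (there (here refl))) = inj₁ refl
comb-parent-edge {mid n}         (here refl)                 = inj₁ refl
comb-parent-edge {mid n}         (there (here refl))         = inj₂ refl
comb-parent-edge {tip n}         (here refl)                 = inj₁ refl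

comb-depth-parent : ∀ {x} → Adj x (parent x) → depth (parent x) < depth x
comb-depth-parent {spine zero}    root-loop = contradiction root-loop (comb-irrefl (spine zero))
comb-depth-parent {spine (suc n)} _         = n<1+n n
comb-depth-parent {mid n}         _         = n<1+n n
comb-depth-parent {tip n}         _         = n<1+n (suc n)

spine-to-root : ∀ n → WalkFromTo (spine n) (spine zero)
spine-to-root zero    = here _
spine-to-root (suc n) = there (there (there (here refl))) (spine-to-root n)

to-root : ∀ x → WalkFromTo x (spine zero)
to-root (spine n) = spine-to-root n
to-root (mid n)   = there (here refl) (spine-to-root n)
to-root (tip n)   = there (here refl) (to-root (mid n))

comb-no-neighbour-sum : (ℝ : RealField) → ¬ LFGraph.NeighbourSumProperty comb ℝ
comb-no-neighbour-sum ℝ (f , f≢0 , f-sum) = f≢0 f≈0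
  where
  open RealField ℝ using (_≈_; 0#)

  f-spine≈0 : ∀ n → f (spine n) ≈ 0#
  f-spine≈0 n = pendant-path≈0 comb ℝ f-sum {m = mid n} refl refl

  f-mid≈0 : ∀ n → f (mid n) ≈ 0#
  f-mid≈0 zero    = remaining-neighbour≈0 comb ℝ f-sum refl (f-spine≈0 0) (f-spine≈0 1 ∷ [])
  f-mid≈0 (suc n) = remaining-neighbour≈0 comb ℝ f-sum refl (f-spine≈0 (suc n))
                      (f-spine≈0 (suc (suc n)) ∷ f-spine≈0 n ∷ [])

  f≈0 : ∀ x → f x ≈ 0#
  f≈0 (spine n) = f-spine≈0 n
  f≈0 (mid n)   = f-mid≈0 n
  f≈0 (tip n)   = neighbours≈0⇒≈0 comb ℝ f-sum (f-mid≈0 n ∷ [])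

theorem5p2 : (ℝ : RealField) →
    Σ LFGraph λ G → LFGraph.IsTree G × LFGraph.Infinite G × ¬ LFGraph.NeighbourSumProperty G ℝ
theorem5p2 ℝ =
  comb ,
  ( reachable⇒connected comb (spine zero) to-root
  , ParentEdges.acyclic comb parent depth comb-parent-edge comb-depth-parent ) ,
  unbounded⇒infinite comb depth (λ n → spine (suc n) , n<1+n n) ,
  comb-no-neighbour-sum ℝ
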